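{- For every integer $m \geq 3$, $\gamma(Q_{m \times (2m-3)}) \leq m-2$.
   Context: The $m \times n$ chessboard has squares $(x,y)$ with $1 \le x \le n$ (column $x$) and $1 \le y \le m$ (row $y$). The queens graph $Q_{m \times n}$ has these squares as vertices; two distinct squares are adjacent if they lie in the same row, the same column, the same difference diagonal (same value of $y-x$) or the same sum diagonal (same value of $y+x$). A set $D$ of squares is a dominating set if every square is in $D$ or adjacent to a square of $D$; $\gamma(Q_{m \times n})$ denotes the minimum size of a dominating set. -}

module Defs where

open import Data.Nat using (ℕ; _+_; _≤_)
open import Data.Fin using (Fin; toℕ)
open import Data.Product using (_×_; Σ; _,_)
open import Data.Sum using (_⊎_)
open import Data.List using (List; length)
open import Data.List.Membership.Propositional using (_∈_)
open import Data.List.Relation.Unary.Any using (Any)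
open import Relation.Binary.PropositionalEquality using (_≡_)

-- A square of the m × n board: (column x, row y), 0-indexed
-- (column x ∈ Fin n stands for column toℕ x + 1, similarly for rows).
Square : ℕ → ℕ → Set
Square m n = Fin n × Fin m

-- Queen adjacency (or equality): same row, same column,
-- same difference diagonal (y - x equal, i.e. y + x' = y' + x),
-- or same sum diagonal (y + x equal).
Attacks : ∀ {m n} → Square m n → Square m n → Set
Attacks (x , y) (x' , y') =
  (toℕ x ≡ toℕ x')
  ⊎ (toℕ y ≡ toℕ y')
  ⊎ (toℕ y + toℕ x' ≡ toℕ y' + toℕ x)
  ⊎ (toℕ y + toℕ x ≡ toℕ y' + toℕ x')

-- D dominates Q_{m×n}: every square is in D or adjacent to a square of D
-- (Attacks is reflexive, so "in D" is covered).
Dominating : (m n : ℕ) → List (Square m n) → Set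
Dominating m n D = (s : Square m n) → Any (λ d → Attacks d s) D

-- γ(Q_{m×n}) ≤ k : there is a dominating set of size at most k.
-- (A list with repetitions has at least as many entries as its underlying set.)
γ≤ : (m n k : ℕ) → Set
γ≤ m n k = Σ (List (Square m n)) (λ D → Dominating m n D × length D ≤ k)

module Submission where

open import Defs
open import Data.Nat using (ℕ; zero; suc; _+_; _*_; _∸_; _≤_; _<_; s≤s; s≤s⁻¹; s<s⁻¹; compare; less; equal; greater)
open import Data.Nat.Properties using (+-comm; ≤-reflexive; m≤m+n; m≤n+m; +-cancelˡ-<; m≤n⇒m<n∨m≡n; m≤n⇒∃[o]m+o≡n)
open import Data.Nat.Tactic.RingSolver using (solve-∀)
open import Data.Fin using (Fin; toℕ; fromℕ; fromℕ<; inject₁; _↑ˡ_) renaming (suc to fsuc)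
open import Data.Fin.Properties using (toℕ<n; toℕ-fromℕ; toℕ-fromℕ<; toℕ-↑ˡ; toℕ-inject₁)
open import Data.Product using (Σ; _×_; _,_)
open import Data.Sum using (_⊎_; inj₁; inj₂)
open import Data.List using (List; tabulate)
open import Data.List.Properties using (length-tabulate)
open import Data.List.Relation.Unary.Any.Properties using (tabulate⁺)
open import Relation.Binary.PropositionalEquality using (_≡_; refl; cong; subst; sym)

-- Put the c queens on the middle column x = c of the (c + 2) × (2c + 1) board, in rows 1, …, c.
-- They attack rows 1, …, c and the middle column directly.  The remaining squares lie in
-- the bottom row y = 0 or the top row y = c + 1; there the square at distance e ∈ [1, c]
-- from the middle column is met by a diagonal through the queen in row e (bottom row)
-- or in row c + 1 − e (top row), the side of the middle column deciding which diagonal.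

QueenAttacks : (x y x′ y′ : ℕ) → Set
QueenAttacks x y x′ y′ = x ≡ x′ ⊎ y ≡ y′ ⊎ y + x′ ≡ y′ + x ⊎ y + x ≡ y′ + x′

-- Row i + 1 rather than i: the queens of the middle column are indexed by i < c.
MiddleColumnAttacks : (c x y : ℕ) → Set
MiddleColumnAttacks c x y = Σ ℕ λ i → i < c × QueenAttacks c (suc i) x y

middleColumnAttacks-row : ∀ {c x y} → y < c → MiddleColumnAttacks c x (suc y)
middleColumnAttacks-row {y = y} y<c = y , y<c , inj₂ (inj₁ refl)

middleColumnAttacks-bottom : ∀ {c x} → 0 < c → x < suc (c + c) → MiddleColumnAttacks c x 0
middleColumnAttacks-bottom {c} {x} 0<c x<n with compare x c
... | less .x d = d , s≤s (m≤n+m d x) , inj₂ (inj₂ (inj₁ (cong suc (+-comm d x))))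
... | equal .x = 0 , 0<c , inj₁ refl
... | greater .c d = d , +-cancelˡ-< c d c (s<s⁻¹ x<n) , inj₂ (inj₂ (inj₂ (cong suc (+-comm d c))))

middleColumnAttacks-top : ∀ {c x} → 0 < c → x < suc (c + c) → MiddleColumnAttacks c x (suc c)
middleColumnAttacks-top {c} {x} 0<c x<n with compare x c
... | less .x d = x , s≤s (m≤m+n x d) , inj₂ (inj₂ (inj₂ (cong suc (+-comm x c))))
... | equal .x = 0 , 0<c , inj₁ refl
... | greater .c d with m≤n⇒∃[o]m+o≡n (+-cancelˡ-< c d c (s<s⁻¹ x<n))
-- Now c = d + e + 1 and x = c + d + 1, met by the queen in row e + 1 = 2c + 1 − x.
...   | e , refl = e , s≤s (m≤n+m e d) , inj₂ (inj₂ (inj₁ (anti-diagonal d e)))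
  where
  anti-diagonal : ∀ d e → suc e + suc (suc (d + e) + d) ≡ suc (suc (d + e)) + suc (d + e)
  anti-diagonal = solve-∀

middleColumnAttacks : ∀ {c x y} → 0 < c → x < suc (c + c) → y < suc (suc c) →
                      MiddleColumnAttacks c x y
middleColumnAttacks {y = zero}  0<c x<n _ = middleColumnAttacks-bottom 0<c x<n
middleColumnAttacks {y = suc y} 0<c x<n y<n with m≤n⇒m<n∨m≡n (s≤s⁻¹ (s≤s⁻¹ y<n))
... | inj₁ y<c  = middleColumnAttacks-row y<c
... | inj₂ refl = middleColumnAttacks-top 0<c x<n

module MiddleColumn (c : ℕ) where

  queen : Fin c → Square (suc (suc c)) (suc (c + c))
  queen i = fromℕ c ↑ˡ c , fsuc (inject₁ i)

  queens : List (Square (suc (suc c)) (suc (c + c)))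
  queens = tabulate queen

  queen-attacks : ∀ i x y → QueenAttacks c (suc (toℕ i)) (toℕ x) (toℕ y) → Attacks (queen i) (x , y)
  queen-attacks i _ _ rewrite toℕ-↑ˡ (fromℕ c) c | toℕ-fromℕ c | toℕ-inject₁ i = λ attacks → attacks

  queens-dominating : 0 < c → Dominating (suc (suc c)) (suc (c + c)) queens
  queens-dominating 0<c (x , y) with middleColumnAttacks 0<c (toℕ<n x) (toℕ<n y)
  ... | i , i<c , attacks = tabulate⁺ (fromℕ< i<c) (queen-attacks _ x y attacks′)
    where
    attacks′ : QueenAttacks c (suc (toℕ (fromℕ< i<c))) (toℕ x) (toℕ y)
    attacks′ = subst (λ k → QueenAttacks c (suc k) (toℕ x) (toℕ y)) (sym (toℕ-fromℕ< i<c)) attacks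

  γ≤-middleColumn : 0 < c → γ≤ (suc (suc c)) (suc (c + c)) c
  γ≤-middleColumn 0<c = queens , queens-dominating 0<c , ≤-reflexive (length-tabulate queen)

open MiddleColumn using (γ≤-middleColumn)

proposition5 : (m : ℕ) → 3 ≤ m → γ≤ m (2 * m ∸ 3) (m ∸ 2)
proposition5 (suc (suc c)) (s≤s (s≤s 0<c)) = subst (λ n → γ≤ (suc (suc c)) n c) (sym columns) (γ≤-middleColumn c 0<c)
  where
  double : ∀ c → 2 * (2 + c) ≡ 3 + suc (c + c)
  double = solve-∀

  columns : 2 * (2 + c) ∸ 3 ≡ suc (c + c)
  columns = cong (_∸ 3) (double c)
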